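{- Let $\Gamma$ be a finite, undirected, connected 3-GNDB graph of diameter $2$. Then for every edge $ab$ of $\Gamma$ with $|W_{ab}|=3|W_{ba}|$, we have $\deg(a)=3\deg(b)$.
   Context: All graphs are finite, simple, undirected and connected, with at least one edge. For vertices $a,b$, $d(a,b)$ denotes the length of a shortest $a$–$b$ path. For an edge $ab$, $W_{ab}=\{x\in V(\Gamma)\mid d(x,a)<d(x,b)\}$. A graph $\Gamma$ is called generalized 3-nicely distance-balanced (3-GNDB) if there is a positive integer $\gamma_\Gamma$ such that for every edge $ab$ of $\Gamma$, one of $|W_{ab}|,|W_{ba}|$ equals $3$ times the other, and the smaller of the two equals $\gamma_\Gamma$. -}

module Defs where

open import Data.Nat using (ℕ; zero; suc; _*_; _<_; _≤_)
open import Data.Fin using (Fin)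
open import Data.Bool using (Bool; T)
open import Data.List using (List; length)
open import Data.List.Membership.Propositional using (_∈_)
open import Data.List.Relation.Unary.Unique.Propositional using (Unique)
open import Data.Product using (Σ; ∃; _×_; _,_)
open import Data.Sum using (_⊎_)
open import Function.Bundles using (_⇔_)
open import Relation.Binary.PropositionalEquality using (_≡_)
open import Relation.Nullary using (¬_)

record Graph : Set where
  field
    n     : ℕ
    adj   : Fin n → Fin n → Bool
    sym   : ∀ a b → adj a b ≡ adj b a
    irrefl : ∀ a → ¬ T (adj a a)

module _ (G : Graph) where
  open Graph G

  Adj : Fin n → Fin n → Set
  Adj a b = T (adj a b)

  data Walk : Fin n → Fin n → ℕ → Set where
    here : ∀ {a} → Walk a a zero
    step : ∀ {a b c k} → Adj a b → Walk b c k → Walk a c (suc k)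

  Dist : Fin n → Fin n → ℕ → Set
  Dist a b k = Walk a b k × (∀ l → Walk a b l → k ≤ l)

  Connected : Set
  Connected = ∀ a b → ∃ λ k → Walk a b k

  Diameter2 : Set
  Diameter2 = (∀ a b k → Dist a b k → k ≤ 2) × (∃ λ a → ∃ λ b → Dist a b 2)

  HasSize : (Fin n → Set) → ℕ → Set
  HasSize P m = ∃ λ (xs : List (Fin n)) →
    Unique xs × (∀ x → (x ∈ xs) ⇔ P x) × length xs ≡ m

  W : Fin n → Fin n → Fin n → Set
  W a b x = ∃ λ k → ∃ λ l → Dist x a k × Dist x b l × k < l

  Degree : Fin n → ℕ → Set
  Degree a m = HasSize (Adj a) m

  GNDB3 : Set
  GNDB3 = ∃ λ γ → 0 < γ × (∀ a b → Adj a b → ∀ p q →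
            HasSize (W a b) p → HasSize (W b a) q →
            (p ≡ 3 * q × q ≡ γ) ⊎ (q ≡ 3 * p × p ≡ γ))

{-# OPTIONS --safe #-}
module Submission where

-- In diameter 2 the vertices closer to a than to b are a itself and the
-- neighbours of a that are neither b nor adjacent to b, so
-- deg a = |W_ab| + (number of common neighbours of a and b).  Hence along every
-- edge of a 3-GNDB graph the degrees differ by exactly 2γ.  Around a triangle
-- three such differences would have to sum to zero, which is impossible as
-- γ > 0; so the graph is triangle-free, deg a = |W_ab| for every edge ab, and
-- |W_ab| = 3|W_ba| becomes deg a = 3 deg b.

open import Defs
open import Data.Nat using (ℕ; zero; suc; _+_; _*_; _<_; _≤_; z≤n; s≤s)
open import Data.Nat.Properties
  using (+-identityʳ; +-cancelˡ-≡; +-cancelʳ-≡; m≢1+n+m; <⇒≱; ≤-<-trans; m≤m+n)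
open import Data.Nat.Tactic.RingSolver using (solve-∀)
open import Data.Bool using (T)
open import Data.Empty using (⊥)
open import Data.Fin using (Fin)
open import Data.Fin.Properties using (_≟_)
open import Data.List using ([]; _∷_; _++_; allFin; filter)
open import Data.List.Properties using (length-++)
open import Data.List.Membership.Propositional using (_∈_)
open import Data.List.Membership.Propositional.Properties
  using (∈-++⁺ˡ; ∈-++⁺ʳ; ∈-++⁻; ∈-filter⁺; ∈-filter⁻; ∈-allFin)
open import Data.List.Membership.Propositional.Properties.WithK using (unique∧set⇒bag)
open import Data.List.Relation.Binary.BagAndSetEquality using (∼bag⇒↭)
open import Data.List.Relation.Binary.Permutation.Propositional.Properties using (↭-length)
open import Data.List.Relation.Unary.All using ([])
open import Data.List.Relation.Unary.AllPairs using ([]; _∷_)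
open import Data.List.Relation.Unary.Any using (here)
open import Data.List.Relation.Unary.Unique.Propositional.Properties using (++⁺; filter⁺; allFin⁺)
open import Data.Product using (∃; _×_; _,_; proj₁; proj₂; swap)
open import Data.Sum using (_⊎_; inj₁; inj₂; [_,_])
open import Function.Base using (_∘_)
open import Function.Bundles using (_⇔_; mk⇔; Equivalence)
open import Function.Construct.Composition using (_⇔-∘_)
open import Function.Construct.Symmetry using (⇔-sym)
open import Relation.Binary.PropositionalEquality
  using (_≡_; _≢_; refl; sym; trans; cong; subst; module ≡-Reasoning)
open import Relation.Nullary using (¬_; yes; no; contradiction)
open import Relation.Nullary.Decidable using (T?; ¬?; _×-dec_; _⊎-dec_; map)
open import Relation.Unary using (Decidable)

-- |x − y| = g, phrased without truncated subtraction.
Gap : ℕ → ℕ → ℕ → Set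
Gap g x y = x ≡ g + y ⊎ y ≡ g + x

n≢g+n : ∀ {g n} → 0 < g → n ≢ g + n
n≢g+n {suc _} {n} _ = m≢1+n+m n

g+n≢g+[g+n] : ∀ {g n} → 0 < g → g + n ≢ g + (g + n)
g+n≢g+[g+n] {g} 0<g = n≢g+n 0<g ∘ +-cancelˡ-≡ g _ _

n≢g+[g+[g+n]] : ∀ {g n} → 0 < g → n ≢ g + (g + (g + n))
n≢g+[g+[g+n]] {suc g} {n} _ e = n≢g+n (s≤s z≤n) (trans e (reassoc (suc g) n))
  where
  reassoc : ∀ g n → g + (g + (g + n)) ≡ (g + (g + g)) + n
  reassoc = solve-∀

no-gap-triangle : ∀ {g x y z} → 0 < g → Gap g x y → Gap g y z → Gap g z x → ⊥
no-gap-triangle 0<g (inj₁ refl) (inj₁ refl) (inj₁ e)    = n≢g+[g+[g+n]] 0<g e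
no-gap-triangle 0<g (inj₁ refl) (inj₁ refl) (inj₂ e)    = g+n≢g+[g+n] 0<g (sym e)
no-gap-triangle 0<g (inj₁ refl) (inj₂ refl) (inj₁ e)    = g+n≢g+[g+n] 0<g e
no-gap-triangle 0<g (inj₁ refl) (inj₂ refl) (inj₂ e)    = g+n≢g+[g+n] 0<g e
no-gap-triangle 0<g (inj₂ refl) (inj₁ e)    (inj₁ refl) = g+n≢g+[g+n] 0<g e
no-gap-triangle 0<g (inj₂ refl) (inj₁ e)    (inj₂ refl) = g+n≢g+[g+n] 0<g (sym e)
no-gap-triangle 0<g (inj₂ refl) (inj₂ refl) (inj₁ e)    = g+n≢g+[g+n] 0<g (sym e)
no-gap-triangle 0<g (inj₂ refl) (inj₂ refl) (inj₂ e)    = n≢g+[g+[g+n]] 0<g e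

tripled⇒gap : ∀ {x y q} → x + q ≡ y + 3 * q → x ≡ 2 * q + y
tripled⇒gap {x} {y} {q} e = +-cancelʳ-≡ q x (2 * q + y) (trans e (reorder y q))
  where
  reorder : ∀ y q → y + 3 * q ≡ 2 * q + y + q
  reorder = solve-∀

module _ (G : Graph) where
  open Graph G using (n; adj; irrefl)

  adj-sym : ∀ {a b} → Adj G a b → Adj G b a
  adj-sym {a} {b} = subst T (Graph.sym G a b)

  adj? : ∀ a → Decidable (Adj G a)
  adj? a x = T? (adj a x)

  HasSize-unique : ∀ {P m m′} → HasSize G P m → HasSize G P m′ → m ≡ m′
  HasSize-unique (xs , xs! , xs⇔P , refl) (ys , ys! , ys⇔P , refl) =
    ↭-length (∼bag⇒↭ (unique∧set⇒bag xs! ys! λ {x} → ⇔-sym (ys⇔P x) ⇔-∘ xs⇔P x))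

  HasSize-cong : ∀ {P Q m} → (∀ x → P x ⇔ Q x) → HasSize G P m → HasSize G Q m
  HasSize-cong P⇔Q (xs , xs! , xs⇔P , len) = xs , xs! , (λ x → P⇔Q x ⇔-∘ xs⇔P x) , len

  HasSize-∅ : ∀ {P} → (∀ {x} → ¬ P x) → HasSize G P 0
  HasSize-∅ ¬P = [] , [] , (λ x → mk⇔ (λ ()) (λ p → contradiction p ¬P)) , refl

  HasSize-≡ : ∀ a → HasSize G (_≡ a) 1
  HasSize-≡ a = a ∷ [] , [] ∷ [] , (λ x → mk⇔ (λ { (here x≡a) → x≡a }) (λ { refl → here refl })) , refl

  HasSize-⊎ : ∀ {P Q : Fin n → Set} {m k} → (∀ {x} → P x → ¬ Q x) →
              HasSize G P m → HasSize G Q k → HasSize G (λ x → P x ⊎ Q x) (m + k)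
  HasSize-⊎ {P} {Q} P⇒¬Q (xs , xs! , xs⇔P , refl) (ys , ys! , ys⇔Q , refl) =
    xs ++ ys , ++⁺ xs! ys! disjoint , (λ x → mk⇔ (∈⇒⊎ x) (⊎⇒∈ x)) , length-++ xs
    where
    open Equivalence
    disjoint : ∀ {x} → ¬ (x ∈ xs × x ∈ ys)
    disjoint {x} (x∈xs , x∈ys) = P⇒¬Q (to (xs⇔P x) x∈xs) (to (ys⇔Q x) x∈ys)
    ∈⇒⊎ : ∀ x → x ∈ xs ++ ys → P x ⊎ Q x
    ∈⇒⊎ x = [ inj₁ ∘ to (xs⇔P x) , inj₂ ∘ to (ys⇔Q x) ] ∘ ∈-++⁻ xs
    ⊎⇒∈ : ∀ x → P x ⊎ Q x → x ∈ xs ++ ys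
    ⊎⇒∈ x = [ ∈-++⁺ˡ ∘ from (xs⇔P x) , ∈-++⁺ʳ xs ∘ from (ys⇔Q x) ]

  HasSize-dec : ∀ {P} → Decidable P → ∃ (HasSize G P)
  HasSize-dec P? =
    _ , filter P? (allFin n) , filter⁺ P? (allFin⁺ n) ,
    (λ x → mk⇔ (proj₂ ∘ ∈-filter⁻ P? {xs = allFin n}) (∈-filter⁺ P? (∈-allFin x))) , refl

  walk-zero : ∀ {x y} → Walk G x y 0 → x ≡ y
  walk-zero here = refl

  walk-one : ∀ {x y} → Walk G x y 1 → Adj G x y
  walk-one (step xy here) = xy

  dist-refl : ∀ {x} → Dist G x x 0
  dist-refl = here , λ _ _ → z≤n

  dist-adj : ∀ {x y} → Adj G x y → Dist G x y 1
  dist-adj {x} xy = step xy here , shortest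
    where
    shortest : ∀ l → Walk G x _ l → 1 ≤ l
    shortest zero    w with refl ← walk-zero w = contradiction xy (irrefl x)
    shortest (suc l) w = s≤s z≤n

  dist-two : ∀ {x y z} → Adj G x z → Adj G z y → x ≢ y → ¬ Adj G x y → Dist G x y 2
  dist-two {x} {y} xz zy x≢y ¬xy = step xz (step zy here) , shortest
    where
    shortest : ∀ l → Walk G x y l → 2 ≤ l
    shortest zero          w = contradiction (walk-zero w) x≢y
    shortest (suc zero)    w = contradiction (walk-one w) ¬xy
    shortest (suc (suc l)) w = s≤s (s≤s z≤n)

  DiameterAtMost2 : Set
  DiameterAtMost2 = ∀ a b k → Dist G a b k → k ≤ 2

  CommonNeighbour : Fin n → Fin n → Fin n → Set
  CommonNeighbour a b x = Adj G a x × Adj G b x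

  PrivateNeighbour : Fin n → Fin n → Fin n → Set
  PrivateNeighbour a b x = Adj G a x × x ≢ b × ¬ Adj G b x

  common? : ∀ a b → Decidable (CommonNeighbour a b)
  common? a b x = adj? a x ×-dec adj? b x

  private? : ∀ a b → Decidable (PrivateNeighbour a b)
  private? a b x = adj? a x ×-dec ¬? (x ≟ b) ×-dec ¬? (adj? b x)

  W⇔self⊎private : DiameterAtMost2 → ∀ {a b} → Adj G a b →
                   ∀ x → W G a b x ⇔ (x ≡ a ⊎ PrivateNeighbour a b x)
  W⇔self⊎private diam {a} {b} ab x = mk⇔ closer⇒ ⇒closer
    where
    closer⇒ : W G a b x → x ≡ a ⊎ PrivateNeighbour a b x
    closer⇒ (zero , _ , (xa , _) , _) = inj₁ (walk-zero xa)
    closer⇒ (suc zero , zero , _ , _ , ())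
    closer⇒ (suc zero , suc zero , _ , _ , s≤s ())
    closer⇒ (suc zero , suc (suc l) , (xa , _) , (_ , xb-shortest) , _) =
      inj₂ (adj-sym (walk-one xa) , x≢b , ¬bx)
      where
      x≢b : x ≢ b
      x≢b refl with () ← xb-shortest 0 here
      ¬bx : ¬ Adj G b x
      ¬bx bx with s≤s () ← xb-shortest 1 (step (adj-sym bx) here)
    closer⇒ (suc (suc k) , l , _ , xb , 2+k<l) =
      contradiction (diam x b l xb) (<⇒≱ (≤-<-trans (m≤m+n 2 k) 2+k<l))
    ⇒closer : x ≡ a ⊎ PrivateNeighbour a b x → W G a b x
    ⇒closer (inj₁ refl) = 0 , 1 , dist-refl , dist-adj ab , s≤s z≤n
    ⇒closer (inj₂ (ax , x≢b , ¬bx)) =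
      1 , 2 , dist-adj (adj-sym ax) , dist-two (adj-sym ax) ab x≢b (¬bx ∘ adj-sym) , s≤s (s≤s z≤n)

  W? : DiameterAtMost2 → ∀ {a b} → Adj G a b → Decidable (W G a b)
  W? diam {a} {b} ab x = map (⇔-sym (W⇔self⊎private diam ab x)) ((x ≟ a) ⊎-dec private? a b x)

  adj⇔other⊎common⊎private : ∀ {a b} → Adj G a b →
    ∀ x → Adj G a x ⇔ (x ≡ b ⊎ CommonNeighbour a b x ⊎ PrivateNeighbour a b x)
  adj⇔other⊎common⊎private {a} {b} ab x = mk⇔ split merge
    where
    split : Adj G a x → x ≡ b ⊎ CommonNeighbour a b x ⊎ PrivateNeighbour a b x
    split ax with x ≟ b | adj? b x
    ... | yes x≡b | _      = inj₁ x≡b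
    ... | no x≢b  | yes bx = inj₂ (inj₁ (ax , bx))
    ... | no x≢b  | no ¬bx = inj₂ (inj₂ (ax , x≢b , ¬bx))
    merge : x ≡ b ⊎ CommonNeighbour a b x ⊎ PrivateNeighbour a b x → Adj G a x
    merge (inj₁ refl)              = ab
    merge (inj₂ (inj₁ (ax , _)))   = ax
    merge (inj₂ (inj₂ (ax , _)))   = ax

  degree≡W+common : DiameterAtMost2 → ∀ {a b w c d} → Adj G a b →
    HasSize G (W G a b) w → HasSize G (CommonNeighbour a b) c → Degree G a d → d ≡ w + c
  degree≡W+common diam {a} {b} {w} {c} {d} ab W-size common-size degree
    with r , private-size ← HasSize-dec (private? a b) = begin
      d             ≡⟨ HasSize-unique degree neighbours-size ⟩
      1 + (c + r)   ≡⟨ reorder c r ⟩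
      1 + r + c     ≡⟨ cong (_+ c) (HasSize-unique closer-size W-size) ⟩
      w + c         ∎
    where
    open ≡-Reasoning
    reorder : ∀ c r → 1 + (c + r) ≡ 1 + r + c
    reorder = solve-∀
    closer-size : HasSize G (W G a b) (1 + r)
    closer-size = HasSize-cong (⇔-sym ∘ W⇔self⊎private diam ab)
      (HasSize-⊎ (λ { refl (aa , _) → irrefl a aa }) (HasSize-≡ a) private-size)
    neighbours-size : Degree G a (1 + (c + r))
    neighbours-size = HasSize-cong (⇔-sym ∘ adj⇔other⊎common⊎private ab)
      (HasSize-⊎ (λ { refl (inj₁ (_ , bb)) → irrefl b bb ; refl (inj₂ (_ , b≢b , _)) → b≢b refl })
        (HasSize-≡ b)
        (HasSize-⊎ (λ { (_ , bx) (_ , _ , ¬bx) → ¬bx bx }) common-size private-size))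

  degree-W-balance : DiameterAtMost2 → ∀ {u v p q du dv} → Adj G u v →
    HasSize G (W G u v) p → HasSize G (W G v u) q → Degree G u du → Degree G v dv →
    du + q ≡ dv + p
  degree-W-balance diam {u} {v} {p} {q} {du} {dv} uv Wuv Wvu deg-u deg-v
    with c , common-size ← HasSize-dec (common? u v) = begin
      du + q       ≡⟨ cong (_+ q) (degree≡W+common diam uv Wuv common-size deg-u) ⟩
      p + c + q    ≡⟨ reorder p c q ⟩
      q + c + p    ≡⟨ cong (_+ p) (degree≡W+common diam (adj-sym uv) Wvu common-size′ deg-v) ⟨
      dv + p       ∎
    where
    open ≡-Reasoning
    reorder : ∀ p c q → p + c + q ≡ q + c + p
    reorder = solve-∀
    common-size′ : HasSize G (CommonNeighbour v u) c
    common-size′ = HasSize-cong (λ _ → mk⇔ swap swap) common-size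

  degree-gap : DiameterAtMost2 → (gndb : GNDB3 G) → ∀ {u v du dv} → Adj G u v →
    Degree G u du → Degree G v dv → Gap (2 * proj₁ gndb) du dv
  degree-gap diam (γ , _ , balanced) {u} {v} uv deg-u deg-v
    with p , Wuv ← HasSize-dec (W? diam uv)
       | q , Wvu ← HasSize-dec (W? diam (adj-sym uv))
    with balanced u v uv p q Wuv Wvu
  ... | inj₁ (refl , refl) = inj₁ (tripled⇒gap (degree-W-balance diam uv Wuv Wvu deg-u deg-v))
  ... | inj₂ (refl , refl) = inj₂ (tripled⇒gap (sym (degree-W-balance diam uv Wuv Wvu deg-u deg-v)))

  triangle-free : DiameterAtMost2 → GNDB3 G → ∀ {a b c} → Adj G a b → Adj G b c → Adj G c a → ⊥
  triangle-free diam gndb@(_ , s≤s z≤n , _) ab bc ca =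
    no-gap-triangle (s≤s z≤n) (gap ab) (gap bc) (gap ca)
    where
    degree : ∀ v → ∃ (Degree G v)
    degree v = HasSize-dec (adj? v)
    gap : ∀ {u v} → Adj G u v → Gap (2 * proj₁ gndb) (proj₁ (degree u)) (proj₁ (degree v))
    gap uv = degree-gap diam gndb uv (proj₂ (degree _)) (proj₂ (degree _))

  degree≡W : DiameterAtMost2 → GNDB3 G → ∀ {a b w d} → Adj G a b →
    HasSize G (W G a b) w → Degree G a d → d ≡ w
  degree≡W diam gndb {a} {b} {w} ab W-size degree =
    trans (degree≡W+common diam ab W-size no-common degree) (+-identityʳ w)
    where
    no-common : HasSize G (CommonNeighbour a b) 0
    no-common = HasSize-∅ λ (ax , bx) → triangle-free diam gndb ab bx (adj-sym ax)

theorem2p2 : (G : Graph) → Connected G → GNDB3 G → Diameter2 G →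
    ∀ a b → Adj G a b → ∀ p q → HasSize G (W G a b) p → HasSize G (W G b a) q →
    p ≡ 3 * q → ∀ da db → Degree G a da → Degree G b db → da ≡ 3 * db
theorem2p2 G _ gndb (diam , _) a b ab p q Wab Wba p≡3q da db deg-a deg-b = begin
  da      ≡⟨ degree≡W G diam gndb ab Wab deg-a ⟩
  p       ≡⟨ p≡3q ⟩
  3 * q   ≡⟨ cong (3 *_) (degree≡W G diam gndb (adj-sym G ab) Wba deg-b) ⟨
  3 * db  ∎
  where open ≡-Reasoning
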